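{- Let $G$ be a finite simple graph, let $\langle a,b:c,d\rangle$ be an alternating 4-cycle in $G$, and let $H$ be the graph obtained from $G$ by the 2-switch on $\langle a,b:c,d\rangle$. If $H$ is not isomorphic to $G$, then $G$ contains one of the configurations (a), (b), (c), (d) described below via an injection $f$ such that performing the 2-switch on $\langle f(p),f(q):f(r),f(s)\rangle$ in $G$ yields exactly $H$ (i.e. this 2-switch deletes and adds exactly the same edges as the 2-switch on $\langle a,b:c,d\rangle$).
   Context: All graphs are finite and simple. An alternating 4-cycle $\langle a,b:c,d\rangle$ in a graph $G$ consists of four distinct vertices with $ab,cd\in E(G)$ and $bc,ad\notin E(G)$; the 2-switch on it deletes $ab,cd$ and adds $bc,ad$. A configuration is a triple $(V,E,F)$ where $(V,E)$ is a graph and $F$ is a set of pairs of vertices of $V$ not in $E$ ("non-edges"). A graph $G$ contains the configuration $(V,E,F)$ (on the vertex set $W$) if there is a bijection $f:V\to W\subseteq V(G)$ such that $f(x)f(y)\in E(G)$ for every $xy\in E$ and $f(x)f(y)\notin E(G)$ for every $xy\in F$; pairs in neither $E$ nor $F$ are unconstrained. The four configurations are: (a) vertices $p,q,r,s,w$; edges $pq,rs,qw,rw$; non-edges $qr,ps,pw,sw$. (b) vertices $p,q,r,s,w$; edges $pq,rs,pw,qw$; non-edges $qr,ps,rw,sw$. (c) vertices $p,q,r,s,y,z$; edges $pq,rs,pz,qy$; non-edges $qr,ps,rz,sy$. (d) vertices $p,q,r,s,y,z$; edges $pq,rs,ry,qz$; non-edges $qr,ps,py,sz$. (In each, $\langle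 p,q:r,s\rangle$ is an alternating 4-cycle.) -}

module Defs where

open import Data.Nat using (ℕ)
open import Data.Fin using (Fin; zero; suc; _≟_)
open import Data.Bool using (Bool; true; false; if_then_else_; _∧_; _∨_)
open import Data.Product using (Σ; _×_; _,_; ∃-syntax)
open import Data.Sum using (_⊎_)
open import Data.List using (List; []; _∷_)
open import Data.List.Relation.Unary.All using (All)
open import Relation.Binary.PropositionalEquality using (_≡_)
open import Relation.Nullary using (¬_)
open import Relation.Nullary.Decidable using (⌊_⌋)
open import Function.Definitions using (Injective)
open import Function.Bundles using (_↔_; Inverse)

record Graph (n : ℕ) : Set where
  field
    adj    : Fin n → Fin n → Bool
    sym    : ∀ x y → adj x y ≡ adj y x
    irrefl : ∀ x → adj x x ≡ false
open Graph public

samePair : ∀ {n} → Fin n → Fin n → Fin n → Fin n → Bool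
samePair x y u v = (⌊ x ≟ u ⌋ ∧ ⌊ y ≟ v ⌋) ∨ (⌊ x ≟ v ⌋ ∧ ⌊ y ≟ u ⌋)

Alt4 : ∀ {n} → Graph n → Fin n → Fin n → Fin n → Fin n → Set
Alt4 G a b c d =
  (¬ a ≡ b) × (¬ a ≡ c) × (¬ a ≡ d) × (¬ b ≡ c) × (¬ b ≡ d) × (¬ c ≡ d) ×
  adj G a b ≡ true × adj G c d ≡ true × adj G b c ≡ false × adj G a d ≡ false

switchAdj : ∀ {n} → Graph n → Fin n → Fin n → Fin n → Fin n →
            Fin n → Fin n → Bool
switchAdj G a b c d x y =
  if samePair x y a b ∨ samePair x y c d then false
  else if samePair x y b c ∨ samePair x y a d then true
  else adj G x y

Isomorphic : ∀ {n} → (Fin n → Fin n → Bool) → (Fin n → Fin n → Bool) → Set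
Isomorphic {n} A B =
  Σ (Fin n ↔ Fin n) λ σ → ∀ x y → A x y ≡ B (Inverse.to σ x) (Inverse.to σ y)

-- A configuration (V,E,F) with V = Fin k, together with the designated
-- vertices p q r s of the alternating 4-cycle <p,q:r,s>.
record Config (k : ℕ) : Set where
  field
    edges    : List (Fin k × Fin k)
    nonEdges : List (Fin k × Fin k)
    p q r s  : Fin k
open Config public

ContainsVia : ∀ {n k} → Graph n → Config k → (Fin k → Fin n) → Set
ContainsVia G C f =
  Injective _≡_ _≡_ f ×
  All (λ { (u , v) → adj G (f u) (f v) ≡ true }) (edges C) ×
  All (λ { (u , v) → adj G (f u) (f v) ≡ false }) (nonEdges C)

ContainsYielding : ∀ {n k} → Graph n → Config k →
                   (Fin n → Fin n → Bool) → Set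
ContainsYielding {n} {k} G C H =
  ∃[ f ] (ContainsVia G C f ×
          (∀ x y → switchAdj G (f (p C)) (f (q C)) (f (r C)) (f (s C)) x y ≡ H x y))

v0 v1 v2 v3 v4 : ∀ {m} → Fin (5 Data.Nat.+ m)
v0 = zero
v1 = suc zero
v2 = suc (suc zero)
v3 = suc (suc (suc zero))
v4 = suc (suc (suc (suc zero)))
v5 : ∀ {m} → Fin (6 Data.Nat.+ m)
v5 = suc (suc (suc (suc (suc zero))))

-- (a): p=0 q=1 r=2 s=3 w=4; edges pq,rs,qw,rw; non-edges qr,ps,pw,sw
configA : Config 5
configA = record
  { edges    = (v0 , v1) ∷ (v2 , v3) ∷ (v1 , v4) ∷ (v2 , v4) ∷ []
  ; nonEdges = (v1 , v2) ∷ (v0 , v3) ∷ (v0 , v4) ∷ (v3 , v4) ∷ []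
  ; p = v0 ; q = v1 ; r = v2 ; s = v3 }

-- (b): edges pq,rs,pw,qw; non-edges qr,ps,rw,sw
configB : Config 5
configB = record
  { edges    = (v0 , v1) ∷ (v2 , v3) ∷ (v0 , v4) ∷ (v1 , v4) ∷ []
  ; nonEdges = (v1 , v2) ∷ (v0 , v3) ∷ (v2 , v4) ∷ (v3 , v4) ∷ []
  ; p = v0 ; q = v1 ; r = v2 ; s = v3 }

-- (c): p=0 q=1 r=2 s=3 y=4 z=5; edges pq,rs,pz,qy; non-edges qr,ps,rz,sy
configC : Config 6
configC = record
  { edges    = (v0 , v1) ∷ (v2 , v3) ∷ (v0 , v5) ∷ (v1 , v4) ∷ []
  ; nonEdges = (v1 , v2) ∷ (v0 , v3) ∷ (v2 , v5) ∷ (v3 , v4) ∷ []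
  ; p = v0 ; q = v1 ; r = v2 ; s = v3 }

-- (d): edges pq,rs,ry,qz; non-edges qr,ps,py,sz
configD : Config 6
configD = record
  { edges    = (v0 , v1) ∷ (v2 , v3) ∷ (v2 , v4) ∷ (v1 , v5) ∷ []
  ; nonEdges = (v1 , v2) ∷ (v0 , v3) ∷ (v0 , v4) ∷ (v3 , v5) ∷ []
  ; p = v0 ; q = v1 ; r = v2 ; s = v3 }

-- If b and d have the same neighbours outside the cycle, transposing b and d
-- maps G onto H (it swaps the deleted edge ab with the added edge ad, and the
-- deleted edge cd with the added edge cb); symmetrically for a and c.  So when
-- H ≇ G there is a vertex w off the cycle separating b from d, and a vertex v
-- off the cycle separating a from c.  The relabelling <a,b:c,d> ↦ <c,d:a,b>
-- performs the same 2-switch and exchanges the roles of b and d, so we may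
-- assume b ~ w ≁ d.  Then v = w with a ~ v gives (b), v = w with c ~ v gives
-- (a), and v ≠ w gives (c) or (d) according to whether a ~ v or c ~ v.
module Submission where

open import Defs
open import Data.Nat using (ℕ)
open import Data.Fin using (Fin; _≟_)
open import Data.Fin.Properties using (any?)
import Data.Fin.Permutation as Permutation
open import Data.Fin.Permutation.Components using (transpose)
open import Data.Bool using (Bool; true; false; _∧_; _∨_)
open import Data.Bool.Properties using (∧-comm; ∨-comm; ∧-zeroʳ; ∨-zeroʳ)
  renaming (_≟_ to _≟ᵇ_)
open import Data.Product using (∃; _×_; _,_)
open import Data.Sum using (_⊎_; inj₁; inj₂)
import Data.Sum as Sum
open import Data.Empty using (⊥-elim)
open import Data.List.Relation.Unary.All using ([]; _∷_)
open import Data.Vec using (Vec; []; _∷_; lookup)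
open import Data.Vec.Relation.Unary.All as VecAll using ([]; _∷_)
open import Data.Vec.Relation.Unary.Unique.Propositional using (Unique; []; _∷_)
open import Data.Vec.Relation.Unary.Unique.Propositional.Properties
  using (lookup-injective)
open import Function.Bundles using (Inverse)
open import Function.Definitions using (Injective)
open import Level using (0ℓ)
open import Relation.Binary.PropositionalEquality
  using (_≡_; _≢_; refl; trans; cong; cong₂; ≢-sym; module ≡-Reasoning)
  renaming (sym to ≡-sym)
open import Relation.Nullary using (Dec; ¬_; yes; no)
open import Relation.Nullary.Decidable
  using (⌊_⌋; isYes≗does; dec-true; dec-false; decidable-stable; ¬?; _×-dec_)
open import Relation.Unary using (Pred; Decidable)

⌊⌋-true : ∀ {A : Set} (a? : Dec A) → A → ⌊ a? ⌋ ≡ true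
⌊⌋-true a? a = trans (isYes≗does a?) (dec-true a? a)

⌊⌋-false : ∀ {A : Set} (a? : Dec A) → ¬ A → ⌊ a? ⌋ ≡ false
⌊⌋-false a? ¬a = trans (isYes≗does a?) (dec-false a? ¬a)

≢⇒true-false⊎false-true : ∀ {x y : Bool} → x ≢ y →
  (x ≡ true × y ≡ false) ⊎ (x ≡ false × y ≡ true)
≢⇒true-false⊎false-true {true}  {true}  x≢y = ⊥-elim (x≢y refl)
≢⇒true-false⊎false-true {true}  {false} _   = inj₁ (refl , refl)
≢⇒true-false⊎false-true {false} {true}  _   = inj₂ (refl , refl)
≢⇒true-false⊎false-true {false} {false} x≢y = ⊥-elim (x≢y refl)

agree⊎disagree : ∀ {n} {P : Pred (Fin n) 0ℓ} → Decidable P → (f g : Fin n → Bool) →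
  (∀ w → P w → f w ≡ g w) ⊎ ∃ λ w → P w × f w ≢ g w
agree⊎disagree P? f g with any? (λ w → P? w ×-dec ¬? (f w ≟ᵇ g w))
... | yes disagreement = inj₂ disagreement
... | no  none         =
  inj₁ λ w Pw → decidable-stable (f w ≟ᵇ g w) (λ fw≢gw → none (w , Pw , fw≢gw))

transpose-ˡ : ∀ {n} (i j : Fin n) → transpose i j i ≡ j
transpose-ˡ i j rewrite dec-true (i ≟ i) refl = refl

transpose-ʳ : ∀ {n} (i j : Fin n) → transpose i j j ≡ i
transpose-ʳ i j with j ≟ i
... | yes j≡i = j≡i
... | no  _   rewrite dec-true (j ≟ j) refl = refl

transpose-other : ∀ {n} {i j k : Fin n} → k ≢ i → k ≢ j → transpose i j k ≡ k
transpose-other {i = i} {j} {k} k≢i k≢j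
  rewrite dec-false (k ≟ i) k≢i | dec-false (k ≟ j) k≢j = refl

module _ {n : ℕ} where

  samePair-refl : ∀ (x y : Fin n) → samePair x y x y ≡ true
  samePair-refl x y rewrite ⌊⌋-true (x ≟ x) refl | ⌊⌋-true (y ≟ y) refl = refl

  samePair-comm : ∀ (x y u v : Fin n) → samePair x y u v ≡ samePair x y v u
  samePair-comm x y u v = ∨-comm (⌊ x ≟ u ⌋ ∧ ⌊ y ≟ v ⌋) (⌊ x ≟ v ⌋ ∧ ⌊ y ≟ u ⌋)

  samePair-sym : ∀ (x y u v : Fin n) → samePair x y u v ≡ samePair y x u v
  samePair-sym x y u v =
    trans (∨-comm (⌊ x ≟ u ⌋ ∧ ⌊ y ≟ v ⌋) (⌊ x ≟ v ⌋ ∧ ⌊ y ≟ u ⌋))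
          (cong₂ _∨_ (∧-comm ⌊ x ≟ v ⌋ ⌊ y ≟ u ⌋) (∧-comm ⌊ x ≟ u ⌋ ⌊ y ≟ v ⌋))

  samePair-offˡ : ∀ {x u v : Fin n} → x ≢ u → x ≢ v → ∀ y → samePair x y u v ≡ false
  samePair-offˡ {x} {u} {v} x≢u x≢v y
    rewrite ⌊⌋-false (x ≟ u) x≢u | ⌊⌋-false (x ≟ v) x≢v = refl

  samePair-offʳ : ∀ x {y u v : Fin n} → y ≢ u → y ≢ v → samePair x y u v ≡ false
  samePair-offʳ x {y} {u} {v} y≢u y≢v =
    trans (samePair-sym x y u v) (samePair-offˡ y≢u y≢v x)

  samePair-diag : ∀ x {u v : Fin n} → u ≢ v → samePair x x u v ≡ false
  samePair-diag x {u} {v} u≢v with x ≟ u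
  ... | yes refl rewrite ⌊⌋-false (x ≟ v) u≢v = refl
  ... | no  _    = ∧-zeroʳ ⌊ x ≟ v ⌋

  OffCycle : Fin n → Fin n → Fin n → Fin n → Pred (Fin n) 0ℓ
  OffCycle a b c d w = w ≢ a × w ≢ b × w ≢ c × w ≢ d

  offCycle? : ∀ (a b c d : Fin n) → Decidable (OffCycle a b c d)
  offCycle? a b c d w = ¬? (w ≟ a) ×-dec ¬? (w ≟ b) ×-dec ¬? (w ≟ c) ×-dec ¬? (w ≟ d)

  offCycle-flip : ∀ {a b c d w : Fin n} → OffCycle a b c d w → OffCycle b a d c w
  offCycle-flip (w≢a , w≢b , w≢c , w≢d) = w≢b , w≢a , w≢d , w≢c

  offCycle-rotate : ∀ {a b c d w : Fin n} → OffCycle a b c d w → OffCycle c d a b w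
  offCycle-rotate (w≢a , w≢b , w≢c , w≢d) = w≢c , w≢d , w≢a , w≢b

  data OnCycle (a b c d : Fin n) : Fin n → Set where
    at-a : OnCycle a b c d a
    at-b : OnCycle a b c d b
    at-c : OnCycle a b c d c
    at-d : OnCycle a b c d d

  onCycle⊎offCycle : ∀ (a b c d x : Fin n) → OnCycle a b c d x ⊎ OffCycle a b c d x
  onCycle⊎offCycle a b c d x with x ≟ a | x ≟ b | x ≟ c | x ≟ d
  ... | yes refl | _        | _        | _        = inj₁ at-a
  ... | no _     | yes refl | _        | _        = inj₁ at-b
  ... | no _     | no _     | yes refl | _        = inj₁ at-c
  ... | no _     | no _     | no _     | yes refl = inj₁ at-d
  ... | no x≢a   | no x≢b   | no x≢c   | no x≢d   = inj₂ (x≢a , x≢b , x≢c , x≢d)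

module _ {n : ℕ} (G : Graph n) where

  adj-flip : ∀ {x y : Fin n} {t : Bool} → adj G x y ≡ t → adj G y x ≡ t
  adj-flip {x} {y} = trans (sym G y x)

  alt4-flip : ∀ {a b c d : Fin n} → Alt4 G a b c d → Alt4 G b a d c
  alt4-flip (a≢b , a≢c , a≢d , b≢c , b≢d , c≢d , ab , cd , bc , ad) =
    ≢-sym a≢b , b≢d , b≢c , a≢d , a≢c , ≢-sym c≢d ,
    adj-flip ab , adj-flip cd , ad , bc

  alt4-rotate : ∀ {a b c d : Fin n} → Alt4 G a b c d → Alt4 G c d a b
  alt4-rotate (a≢b , a≢c , a≢d , b≢c , b≢d , c≢d , ab , cd , bc , ad) =
    c≢d , ≢-sym a≢c , ≢-sym b≢c , ≢-sym a≢d , ≢-sym b≢d , a≢b ,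
    cd , ab , adj-flip ad , adj-flip bc

  switchAdj-sym : ∀ (a b c d x y : Fin n) →
    switchAdj G a b c d x y ≡ switchAdj G a b c d y x
  switchAdj-sym a b c d x y
    rewrite samePair-sym x y a b | samePair-sym x y c d
          | samePair-sym x y b c | samePair-sym x y a d | sym G x y = refl

  switchAdj-flip : ∀ (a b c d x y : Fin n) →
    switchAdj G b a d c x y ≡ switchAdj G a b c d x y
  switchAdj-flip a b c d x y
    rewrite samePair-comm x y b a | samePair-comm x y d c
          | ∨-comm (samePair x y a d) (samePair x y b c) = refl

  switchAdj-rotate : ∀ (a b c d x y : Fin n) →
    switchAdj G c d a b x y ≡ switchAdj G a b c d x y
  switchAdj-rotate a b c d x y
    rewrite ∨-comm (samePair x y c d) (samePair x y a b)
          | samePair-comm x y d a | samePair-comm x y c b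
          | ∨-comm (samePair x y a d) (samePair x y b c) = refl

  switchAdj-off : ∀ {a b c d x : Fin n} → OffCycle a b c d x → ∀ y →
    switchAdj G a b c d x y ≡ adj G x y
  switchAdj-off (x≢a , x≢b , x≢c , x≢d) y
    rewrite samePair-offˡ x≢a x≢b y | samePair-offˡ x≢c x≢d y
          | samePair-offˡ x≢b x≢c y | samePair-offˡ x≢a x≢d y = refl

  switchAdj-irrefl : ∀ {a b c d : Fin n} → Alt4 G a b c d → ∀ x →
    switchAdj G a b c d x x ≡ false
  switchAdj-irrefl (a≢b , _ , a≢d , b≢c , _ , c≢d , _) x
    rewrite samePair-diag x a≢b | samePair-diag x c≢d
          | samePair-diag x b≢c | samePair-diag x a≢d = irrefl G x

  switchAdj-ab : ∀ (a b c d : Fin n) → switchAdj G a b c d a b ≡ false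
  switchAdj-ab a b c d rewrite samePair-refl a b = refl

  switchAdj-dc : ∀ (a b c d : Fin n) → switchAdj G a b c d d c ≡ false
  switchAdj-dc a b c d
    rewrite samePair-comm d c c d | samePair-refl d c | ∨-zeroʳ (samePair d c a b) = refl

  switchAdj-ad : ∀ {a b c d : Fin n} → Alt4 G a b c d → switchAdj G a b c d a d ≡ true
  switchAdj-ad {a} {b} {c} {d} (a≢b , a≢c , a≢d , _ , b≢d , _)
    rewrite samePair-offʳ a (≢-sym a≢d) (≢-sym b≢d) | samePair-offˡ a≢c a≢d d
          | samePair-offˡ a≢b a≢c d | samePair-refl a d = refl

  switchAdj-cb : ∀ {a b c d : Fin n} → Alt4 G a b c d → switchAdj G a b c d c b ≡ true
  switchAdj-cb {a} {b} {c} {d} (_ , a≢c , _ , b≢c , b≢d , _)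
    rewrite samePair-offˡ (≢-sym a≢c) (≢-sym b≢c) b | samePair-offʳ c b≢c b≢d
          | samePair-comm c b b c | samePair-refl c b = refl

  switchAdj-ac : ∀ {a b c d : Fin n} → Alt4 G a b c d → switchAdj G a b c d a c ≡ adj G a c
  switchAdj-ac {a} {b} {c} {d} (a≢b , a≢c , a≢d , b≢c , _ , c≢d , _)
    rewrite samePair-offʳ a (≢-sym a≢c) (≢-sym b≢c) | samePair-offˡ a≢c a≢d c
          | samePair-offˡ a≢b a≢c c | samePair-offʳ a (≢-sym a≢c) c≢d = refl

  switchAdj-db : ∀ {a b c d : Fin n} → Alt4 G a b c d → switchAdj G a b c d d b ≡ adj G d b
  switchAdj-db {a} {b} {c} {d} (a≢b , _ , a≢d , b≢c , b≢d , c≢d , _)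
    rewrite samePair-offˡ (≢-sym a≢d) (≢-sym b≢d) b | samePair-offʳ d b≢c b≢d
          | samePair-offˡ (≢-sym b≢d) (≢-sym c≢d) b | samePair-offʳ d (≢-sym a≢b) b≢d = refl

  TwinsOffCycle : Fin n → Fin n → Fin n → Fin n → Set
  TwinsOffCycle a b c d = ∀ w → OffCycle a b c d w → adj G b w ≡ adj G d w

  twin-neighbours : ∀ {a b c d x : Fin n} →
    TwinsOffCycle a b c d →
    OffCycle a b c d x → adj G x b ≡ adj G x d
  twin-neighbours {b = b} {d = d} {x} twins x∉ =
    trans (sym G x b) (trans (twins x x∉) (sym G d x))

  transpose-twins-off : ∀ {a b c d x : Fin n} →
    TwinsOffCycle a b c d →
    OffCycle a b c d x → ∀ y → adj G x y ≡ adj G x (transpose b d y)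
  transpose-twins-off {b = b} {d = d} twins x∉ y with y ≟ b
  ... | yes refl = twin-neighbours twins x∉
  ... | no _ with y ≟ d
  ...   | yes refl = ≡-sym (twin-neighbours twins x∉)
  ...   | no _     = refl

  transposed-sym : ∀ {a b c d x y : Fin n} (σ : Fin n → Fin n) →
    adj G y x ≡ switchAdj G a b c d (σ y) (σ x) →
    adj G x y ≡ switchAdj G a b c d (σ x) (σ y)
  transposed-sym {a} {b} {c} {d} {x} {y} σ e =
    trans (sym G x y) (trans e (switchAdj-sym a b c d (σ y) (σ x)))

  transpose-preserves-off-cycle : ∀ {a b c d x : Fin n} →
    TwinsOffCycle a b c d →
    OffCycle a b c d x → ∀ y →
    adj G x y ≡ switchAdj G a b c d (transpose b d x) (transpose b d y)
  transpose-preserves-off-cycle {a} {b} {c} {d} {x} twins x∉@(_ , x≢b , _ , x≢d) y = begin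
    adj G x y      ≡⟨ transpose-twins-off twins x∉ y ⟩
    adj G x (τ y)  ≡⟨ switchAdj-off x∉ (τ y) ⟨
    H x (τ y)      ≡⟨ cong (λ z → H z (τ y)) (transpose-other x≢b x≢d) ⟨
    H (τ x) (τ y)  ∎
    where
    open ≡-Reasoning

    H : Fin n → Fin n → Bool
    H = switchAdj G a b c d

    τ : Fin n → Fin n
    τ = transpose b d

  transpose-preserves-on-cycle : ∀ {a b c d x y : Fin n} → Alt4 G a b c d →
    OnCycle a b c d x → OnCycle a b c d y →
    adj G x y ≡ switchAdj G a b c d (transpose b d x) (transpose b d y)
  transpose-preserves-on-cycle {a} {b} {c} {d}
    alt@(a≢b , _ , a≢d , b≢c , _ , c≢d , ab , cd , bc , ad) = on-cycle
    where
    H : Fin n → Fin n → Bool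
    H = switchAdj G a b c d

    τ : Fin n → Fin n
    τ = transpose b d

    τa : τ a ≡ a
    τa = transpose-other a≢b a≢d

    τb : τ b ≡ d
    τb = transpose-ˡ b d

    τc : τ c ≡ c
    τc = transpose-other (≢-sym b≢c) c≢d

    τd : τ d ≡ b
    τd = transpose-ʳ b d

    moved : ∀ {x y x′ y′} → τ x ≡ x′ → τ y ≡ y′ → adj G x y ≡ H x′ y′ →
            adj G x y ≡ H (τ x) (τ y)
    moved refl refl e = e

    diagonal : ∀ x → adj G x x ≡ H (τ x) (τ x)
    diagonal x = trans (irrefl G x) (≡-sym (switchAdj-irrefl alt (τ x)))

    ab↦ad : adj G a b ≡ H (τ a) (τ b)
    ab↦ad = moved τa τb (trans ab (≡-sym (switchAdj-ad alt)))

    ac↦ac : adj G a c ≡ H (τ a) (τ c)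
    ac↦ac = moved τa τc (≡-sym (switchAdj-ac alt))

    ad↦ab : adj G a d ≡ H (τ a) (τ d)
    ad↦ab = moved τa τd (trans ad (≡-sym (switchAdj-ab a b c d)))

    bc↦dc : adj G b c ≡ H (τ b) (τ c)
    bc↦dc = moved τb τc (trans bc (≡-sym (switchAdj-dc a b c d)))

    bd↦db : adj G b d ≡ H (τ b) (τ d)
    bd↦db = moved τb τd (trans (sym G b d) (≡-sym (switchAdj-db alt)))

    cd↦cb : adj G c d ≡ H (τ c) (τ d)
    cd↦cb = moved τc τd (trans cd (≡-sym (switchAdj-cb alt)))

    on-cycle : ∀ {x y} → OnCycle a b c d x → OnCycle a b c d y → adj G x y ≡ H (τ x) (τ y)
    on-cycle at-a at-a = diagonal a
    on-cycle at-a at-b = ab↦ad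
    on-cycle at-a at-c = ac↦ac
    on-cycle at-a at-d = ad↦ab
    on-cycle at-b at-a = transposed-sym τ ab↦ad
    on-cycle at-b at-b = diagonal b
    on-cycle at-b at-c = bc↦dc
    on-cycle at-b at-d = bd↦db
    on-cycle at-c at-a = transposed-sym τ ac↦ac
    on-cycle at-c at-b = transposed-sym τ bc↦dc
    on-cycle at-c at-c = diagonal c
    on-cycle at-c at-d = cd↦cb
    on-cycle at-d at-a = transposed-sym τ ad↦ab
    on-cycle at-d at-b = transposed-sym τ bd↦db
    on-cycle at-d at-c = transposed-sym τ cd↦cb
    on-cycle at-d at-d = diagonal d

  twins⇒switch-isomorphic : ∀ {a b c d : Fin n} → Alt4 G a b c d →
    TwinsOffCycle a b c d →
    Isomorphic (adj G) (switchAdj G a b c d)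
  twins⇒switch-isomorphic {a} {b} {c} {d} alt twins = Permutation.transpose b d , preserves
    where
    preserves : ∀ x y →
      adj G x y ≡ switchAdj G a b c d (transpose b d x) (transpose b d y)
    preserves x y with onCycle⊎offCycle a b c d x | onCycle⊎offCycle a b c d y
    ... | inj₂ x∉ | _       = transpose-preserves-off-cycle twins x∉ y
    ... | _       | inj₂ y∉ =
      transposed-sym (transpose b d) (transpose-preserves-off-cycle twins y∉ x)
    ... | inj₁ x∈ | inj₁ y∈ = transpose-preserves-on-cycle alt x∈ y∈

  Configurations : (Fin n → Fin n → Bool) → Set
  Configurations H =
    ContainsYielding G configA H ⊎ ContainsYielding G configB H ⊎
    ContainsYielding G configC H ⊎ ContainsYielding G configD H

  containsYielding-resp : ∀ {k} {C : Config k} {H H′ : Fin n → Fin n → Bool} →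
    (∀ x y → H x y ≡ H′ x y) → ContainsYielding G C H → ContainsYielding G C H′
  containsYielding-resp H≗H′ (f , embedding , yields) =
    f , embedding , λ x y → trans (yields x y) (H≗H′ x y)

  configurations-resp : ∀ {H H′ : Fin n → Fin n → Bool} →
    (∀ x y → H x y ≡ H′ x y) → Configurations H → Configurations H′
  configurations-resp {H} {H′} H≗H′ = Sum.map resp (Sum.map resp (Sum.map resp resp))
    where
    resp : ∀ {k} {C : Config k} → ContainsYielding G C H → ContainsYielding G C H′
    resp = containsYielding-resp H≗H′

  isomorphic-resp : ∀ {A H H′ : Fin n → Fin n → Bool} →
    (∀ x y → H x y ≡ H′ x y) → Isomorphic A H → Isomorphic A H′
  isomorphic-resp H≗H′ (σ , preserves) =
    σ , λ x y → trans (preserves x y) (H≗H′ (Inverse.to σ x) (Inverse.to σ y))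

  cycle-lookup-injective : ∀ {a b c d : Fin n} {k} {ws : Vec (Fin n) k} →
    Alt4 G a b c d → VecAll.All (OffCycle a b c d) ws → Unique ws →
    Injective _≡_ _≡_ (lookup (a ∷ b ∷ c ∷ d ∷ ws))
  cycle-lookup-injective {a} {b} {c} {d} {ws = ws}
    (a≢b , a≢c , a≢d , b≢c , b≢d , c≢d , _) ws∉ ws! {i} {j} = lookup-injective unique i j
    where
    unique : Unique (a ∷ b ∷ c ∷ d ∷ ws)
    unique =
        (a≢b ∷ a≢c ∷ a≢d ∷ VecAll.map (λ (w≢a , _) → ≢-sym w≢a) ws∉)
      ∷ (b≢c ∷ b≢d ∷ VecAll.map (λ (_ , w≢b , _) → ≢-sym w≢b) ws∉)
      ∷ (c≢d ∷ VecAll.map (λ (_ , _ , w≢c , _) → ≢-sym w≢c) ws∉)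
      ∷ VecAll.map (λ (_ , _ , _ , w≢d) → ≢-sym w≢d) ws∉
      ∷ ws!

  contains-a : ∀ {a b c d w : Fin n} → Alt4 G a b c d → OffCycle a b c d w →
    adj G a w ≡ false → adj G b w ≡ true → adj G c w ≡ true → adj G d w ≡ false →
    ContainsYielding G configA (switchAdj G a b c d)
  contains-a {a} {b} {c} {d} {w} alt@(_ , _ , _ , _ , _ , _ , ab , cd , bc , ad) w∉ aw bw cw dw =
    lookup (a ∷ b ∷ c ∷ d ∷ w ∷ []) ,
    (cycle-lookup-injective alt (w∉ ∷ []) ([] ∷ []) ,
     ab ∷ cd ∷ bw ∷ cw ∷ [] , bc ∷ ad ∷ aw ∷ dw ∷ []) ,
    λ _ _ → refl

  contains-b : ∀ {a b c d w : Fin n} → Alt4 G a b c d → OffCycle a b c d w →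
    adj G a w ≡ true → adj G b w ≡ true → adj G c w ≡ false → adj G d w ≡ false →
    ContainsYielding G configB (switchAdj G a b c d)
  contains-b {a} {b} {c} {d} {w} alt@(_ , _ , _ , _ , _ , _ , ab , cd , bc , ad) w∉ aw bw cw dw =
    lookup (a ∷ b ∷ c ∷ d ∷ w ∷ []) ,
    (cycle-lookup-injective alt (w∉ ∷ []) ([] ∷ []) ,
     ab ∷ cd ∷ aw ∷ bw ∷ [] , bc ∷ ad ∷ cw ∷ dw ∷ []) ,
    λ _ _ → refl

  contains-c : ∀ {a b c d w v : Fin n} → Alt4 G a b c d →
    OffCycle a b c d w → OffCycle a b c d v → w ≢ v →
    adj G b w ≡ true → adj G d w ≡ false → adj G a v ≡ true → adj G c v ≡ false →
    ContainsYielding G configC (switchAdj G a b c d)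
  contains-c {a} {b} {c} {d} {w} {v} alt@(_ , _ , _ , _ , _ , _ , ab , cd , bc , ad)
    w∉ v∉ w≢v bw dw av cv =
    lookup (a ∷ b ∷ c ∷ d ∷ w ∷ v ∷ []) ,
    (cycle-lookup-injective alt (w∉ ∷ v∉ ∷ []) ((w≢v ∷ []) ∷ [] ∷ []) ,
     ab ∷ cd ∷ av ∷ bw ∷ [] , bc ∷ ad ∷ cv ∷ dw ∷ []) ,
    λ _ _ → refl

  contains-d : ∀ {a b c d w v : Fin n} → Alt4 G a b c d →
    OffCycle a b c d w → OffCycle a b c d v → w ≢ v →
    adj G b w ≡ true → adj G d w ≡ false → adj G a v ≡ false → adj G c v ≡ true →
    ContainsYielding G configD (switchAdj G a b c d)
  contains-d {a} {b} {c} {d} {w} {v} alt@(_ , _ , _ , _ , _ , _ , ab , cd , bc , ad)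
    w∉ v∉ w≢v bw dw av cv =
    lookup (a ∷ b ∷ c ∷ d ∷ v ∷ w ∷ []) ,
    (cycle-lookup-injective alt (v∉ ∷ w∉ ∷ []) ((≢-sym w≢v ∷ []) ∷ [] ∷ []) ,
     ab ∷ cd ∷ cv ∷ bw ∷ [] , bc ∷ ad ∷ av ∷ dw ∷ []) ,
    λ _ _ → refl

  separators⇒configurations : ∀ {a b c d w v : Fin n} → Alt4 G a b c d →
    OffCycle a b c d w → OffCycle a b c d v →
    adj G b w ≡ true → adj G d w ≡ false → adj G a v ≢ adj G c v →
    Configurations (switchAdj G a b c d)
  separators⇒configurations {w = w} {v} alt w∉ v∉ bw dw av≢cv
    with w ≟ v | ≢⇒true-false⊎false-true av≢cv
  ... | yes refl | inj₁ (aw , cw) = inj₂ (inj₁ (contains-b alt w∉ aw bw cw dw))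
  ... | yes refl | inj₂ (aw , cw) = inj₁ (contains-a alt w∉ aw bw cw dw)
  ... | no w≢v   | inj₁ (av , cv) = inj₂ (inj₂ (inj₁ (contains-c alt w∉ v∉ w≢v bw dw av cv)))
  ... | no w≢v   | inj₂ (av , cv) = inj₂ (inj₂ (inj₂ (contains-d alt w∉ v∉ w≢v bw dw av cv)))

theorem2p2 : ∀ {n : ℕ} (G : Graph n) (a b c d : Fin n) →
    Alt4 G a b c d →
    ¬ Isomorphic (adj G) (switchAdj G a b c d) →
    ContainsYielding G configA (switchAdj G a b c d) ⊎
    ContainsYielding G configB (switchAdj G a b c d) ⊎
    ContainsYielding G configC (switchAdj G a b c d) ⊎
    ContainsYielding G configD (switchAdj G a b c d)
theorem2p2 G a b c d alt H≇G
  with agree⊎disagree (offCycle? a b c d) (adj G b) (adj G d)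
     | agree⊎disagree (offCycle? a b c d) (adj G a) (adj G c)
... | inj₁ bd-twins | _ = ⊥-elim (H≇G (twins⇒switch-isomorphic G alt bd-twins))
... | _ | inj₁ ac-twins =
  ⊥-elim (H≇G (isomorphic-resp G (switchAdj-flip G a b c d)
    (twins⇒switch-isomorphic G (alt4-flip G alt) (λ w w∉ → ac-twins w (offCycle-flip w∉)))))
... | inj₂ (w , w∉ , bw≢dw) | inj₂ (v , v∉ , av≢cv) with ≢⇒true-false⊎false-true bw≢dw
...   | inj₁ (bw , dw) = separators⇒configurations G alt w∉ v∉ bw dw av≢cv
...   | inj₂ (bw , dw) =
  configurations-resp G (switchAdj-rotate G a b c d)
    (separators⇒configurations G (alt4-rotate G alt)
      (offCycle-rotate w∉) (offCycle-rotate v∉) dw bw (≢-sym av≢cv))
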